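{- Let $C>1$ be an integer, let $G$ be an $n$-vertex $k$-uniform hypergraph ($k\ge 2$), and let $0<p=p(n)\leq 1$. If $G$ satisfies $\mathrm{BDD}(2,C,p)$, then $G$ satisfies $\mathrm{BDD}_i(2,C,p)$ for all $1\leq i\leq k-1$.
   Context: For a $k$-uniform hypergraph $G=(V,E)$, $1\le i\le k-1$ and an $i$-set $S\in\binom{V}{i}$, let $N_G(S)=\{T\in\binom{V}{k-i}: S\cup T\in E\}$. $G$ (on $n$ vertices) satisfies $\mathrm{BDD}_i(d,C,p)$ if for all $1\le r\le d$ and all distinct $S_1,\dots,S_r\in\binom{V}{i}$ we have $|N_G(S_1)\cap\dots\cap N_G(S_r)|\le Cn^{k-i}p^r$. The property $\mathrm{BDD}(d,C,p)$ is $\mathrm{BDD}_{k-1}(d,C,p)$, i.e. $|N_G(S_1)\cap\dots\cap N_G(S_r)|\le Cnp^r$ for all $1\le r\le d$ and distinct $S_1,\dots,S_r\in\binom{V}{k-1}$ (here $N_G(S)$ is identified with a set of vertices).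
   Formalization: The parameter p takes only rational values in the interval between 0 and 1. -}

module Defs where

open import Data.Nat using (ℕ; zero; suc; _∸_; _≤_; _<_; _≡ᵇ_)
open import Data.Bool using (Bool; true; false; _∧_)
open import Data.List using (List; []; _∷_; _++_; map; filterᵇ; length)
open import Data.Vec using (Vec; lookup; toList; _∷_)
import Data.Vec as V
open import Data.Fin using (Fin)
open import Data.Fin.Subset using (Subset; _∪_; ∣_∣; outside; inside)
open import Data.Integer using (+_)
open import Data.Rational using (ℚ; _*_; 1ℚ; _/_) renaming (_≤_ to _≤ℚ_)
open import Relation.Binary.PropositionalEquality using (_≡_)

ℕ→ℚ : ℕ → ℚ
ℕ→ℚ m = + m / 1

_^ℚ_ : ℚ → ℕ → ℚ
q ^ℚ zero = 1ℚ
q ^ℚ suc m = q * (q ^ℚ m)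

allSubsets : (n : ℕ) → List (Subset n)
allSubsets zero = V.[] ∷ []
allSubsets (suc n) = map (outside ∷_) (allSubsets n) ++ map (inside ∷_) (allSubsets n)

record Hypergraph (n k : ℕ) : Set where
  field
    edge    : Subset n → Bool
    uniform : ∀ e → edge e ≡ true → ∣ e ∣ ≡ k
open Hypergraph public

-- | N_G(S_1) ∩ ... ∩ N_G(S_r) | for i-sets S_j :
-- number of (k-i)-sets T with S_j ∪ T ∈ E for every j
commonNbhdSize : ∀ {n k r} → Hypergraph n k → (i : ℕ) → Vec (Subset n) r → ℕ
commonNbhdSize {n} {k} G i Ss =
  length (filterᵇ (λ T → (∣ T ∣ ≡ᵇ (k ∸ i)) ∧ V.foldr _ (λ S b → edge G (S ∪ T) ∧ b) true Ss)
                  (allSubsets n))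

BDDᵢ : ∀ {n k} → Hypergraph n k → (i d : ℕ) → (C : ℕ) → ℚ → Set
BDDᵢ {n} {k} G i d C p =
  ∀ (r : ℕ) → 1 ≤ r → r ≤ d →
  (Ss : Vec (Subset n) r) →
  (∀ a b → lookup Ss a ≡ lookup Ss b → a ≡ b) →
  (∀ a → ∣ lookup Ss a ∣ ≡ i) →
  ℕ→ℚ (commonNbhdSize G i Ss) ≤ℚ ℕ→ℚ C * (ℕ→ℚ n ^ℚ (k ∸ i)) * (p ^ℚ r)

BDD : ∀ {n k} → Hypergraph n k → (d : ℕ) → (C : ℕ) → ℚ → Set
BDD {k = k} G d C p = BDDᵢ G (k ∸ 1) d C p

-- Downward induction on i. Fix i < k and distinct i-sets S₁, …, S_r. Every
-- (k-i)-set in N(S₁) ∩ … ∩ N(S_r) is X ∪ {v} for some vertex v and some X ∌ v,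
-- so its size is at most the sum over v of the number of such X. If v lies in
-- some Sⱼ there is no such X, since Sⱼ ∪ X ∪ {v} = Sⱼ ∪ X would be an edge with
-- fewer than k vertices. Otherwise each such X lies in the common neighbourhood of
-- the distinct (i+1)-sets S₁ ∪ {v}, …, S_r ∪ {v}, of size at most C n^(k-i-1) p^r.
-- Summing over the n vertices gives C n^(k-i) p^r. Besides BDD(2, C, p), only
-- p ≥ 0 is used.
module Submission where

open import Defs
open import Data.Bool using (Bool; true; false; T; T?; not; _∧_; _∨_)
import Data.Bool as Bool
open import Data.Bool.Properties using (T-∧; T-≡; T-not-≡; ¬-not; ∨-zeroʳ)
open import Data.Fin using (Fin; zero; suc)
open import Data.Fin.Properties using (any?)
open import Data.Fin.Subset using (Subset; _∪_; ∣_∣; ⊥; inside; outside)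
open import Data.Fin.Subset.Properties using (∣⊥∣≡0)
import Data.Integer as ℤ
import Data.Integer.Properties as ℤ
open import Data.List using (List; []; _∷_; _++_; map; filterᵇ; length)
open import Data.List.Properties using (filter-++; filter-none; length-++)
import Data.List.Relation.Unary.All as All
open import Data.List.Relation.Binary.Sublist.Propositional using (⊆-refl)
open import Data.List.Relation.Binary.Sublist.Propositional.Properties using (filter⁺; length-mono-≤)
open import Data.Nat using (ℕ; zero; suc; _+_; z≤n; s≤s; z<s; _≤_; _<_; _∸_; _≡ᵇ_)
import Data.Nat.Properties as ℕ
import Data.Nat.Coprimality as Coprime
open import Data.Product using (_×_; _,_; proj₁; proj₂)
open import Data.Rational using (ℚ; 0ℚ; 1ℚ; mkℚ; *≤*) renaming (_≤_ to _≤ℚ_; _<_ to _<ℚ_)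
import Data.Rational as ℚ
import Data.Rational.Properties as ℚ
open import Data.Rational.Solver using (module +-*-Solver)
open import Data.Vec using (Vec; []; _∷_; lookup; _[_]≔_)
import Data.Vec as Vec
open import Data.Vec.Properties using ([]≔-idempotent; []≔-lookup; lookup-map)
open import Function using (_∘_)
open import Function.Bundles using (module Equivalence)
open import Relation.Nullary using (¬_; yes; no)
open import Relation.Binary.PropositionalEquality
open import Algebra.Properties.Monoid.Sum ℕ.+-0-monoid using (sum-syntax)

open Equivalence using (to; from)

count : ∀ {n} → (Subset n → Bool) → ℕ
count {n} P = length (filterᵇ P (allSubsets n))

length-filterᵇ-map : ∀ {A B : Set} (P : B → Bool) (f : A → B) (xs : List A) →
  length (filterᵇ P (map f xs)) ≡ length (filterᵇ (P ∘ f) xs)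
length-filterᵇ-map P f []       = refl
length-filterᵇ-map P f (x ∷ xs) with P (f x)
... | true  = cong suc (length-filterᵇ-map P f xs)
... | false = length-filterᵇ-map P f xs

count-∷ : ∀ {n} (P : Subset (suc n) → Bool) →
  count P ≡ count (P ∘ (outside ∷_)) + count (P ∘ (inside ∷_))
count-∷ {n} P = begin
  count P                                             ≡⟨ cong length (filter-++ (T? ∘ P) outs ins) ⟩
  length (filterᵇ P outs ++ filterᵇ P ins)            ≡⟨ length-++ (filterᵇ P outs) ⟩
  length (filterᵇ P outs) + length (filterᵇ P ins)    ≡⟨ cong₂ _+_ (length-filterᵇ-map P _ (allSubsets n))
                                                           (length-filterᵇ-map P _ (allSubsets n)) ⟩
  count (P ∘ (outside ∷_)) + count (P ∘ (inside ∷_))  ∎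
  where
  open ≡-Reasoning
  outs = map (outside ∷_) (allSubsets n)
  ins  = map (inside ∷_) (allSubsets n)

count-∘outside≤ : ∀ {n} (P : Subset (suc n) → Bool) → count (P ∘ (outside ∷_)) ≤ count P
count-∘outside≤ P = ℕ.≤-trans (ℕ.m≤m+n _ _) (ℕ.≤-reflexive (sym (count-∷ P)))

count-mono : ∀ {n} {P Q : Subset n → Bool} → (∀ X → T (P X) → T (Q X)) → count P ≤ count Q
count-mono {n} {P} {Q} P⇒Q =
  length-mono-≤ (filter⁺ (T? ∘ P) (T? ∘ Q) (λ { refl → P⇒Q _ }) (⊆-refl {x = allSubsets n}))

count-none : ∀ {n} (P : Subset n → Bool) → (∀ X → ¬ T (P X)) → count P ≡ 0
count-none {n} P ¬P = cong length (filter-none (T? ∘ P) {allSubsets n} (All.universal ¬P (allSubsets n)))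

∑-mono-≤ : ∀ {m} {f g : Fin m → ℕ} → (∀ v → f v ≤ g v) → ∑[ v < m ] f v ≤ ∑[ v < m ] g v
∑-mono-≤ {zero}  f≤g = z≤n
∑-mono-≤ {suc m} f≤g = ℕ.+-mono-≤ (f≤g zero) (∑-mono-≤ (f≤g ∘ suc))

insert : ∀ {n} → Fin n → Subset n → Subset n
insert v X = X [ v ]≔ inside

∣insert∣ : ∀ {n} (v : Fin n) X → lookup X v ≡ outside → ∣ insert v X ∣ ≡ suc ∣ X ∣
∣insert∣ zero    (outside ∷ X) refl = refl
∣insert∣ (suc v) (outside ∷ X) v∉X  = ∣insert∣ v X v∉X
∣insert∣ (suc v) (inside ∷ X)  v∉X  = cong suc (∣insert∣ v X v∉X)

∪-insert-swap : ∀ {n} (v : Fin n) S X → S ∪ insert v X ≡ insert v S ∪ X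
∪-insert-swap zero    (s ∷ S) (x ∷ X) = cong (_∷ S ∪ X) (∨-zeroʳ s)
∪-insert-swap (suc v) (s ∷ S) (x ∷ X) = cong ((s ∨ x) ∷_) (∪-insert-swap v S X)

∪-insert-absorb : ∀ {n} (v : Fin n) S X → lookup S v ≡ inside → S ∪ insert v X ≡ S ∪ X
∪-insert-absorb zero    (inside ∷ S) (x ∷ X) refl = refl
∪-insert-absorb (suc v) (s ∷ S)      (x ∷ X) v∈S  = cong ((s ∨ x) ∷_) (∪-insert-absorb v S X v∈S)

remove-insert : ∀ {n} (v : Fin n) X → lookup X v ≡ outside → insert v X [ v ]≔ outside ≡ X
remove-insert v X v∉X = begin
  insert v X [ v ]≔ outside  ≡⟨ []≔-idempotent X v ⟩
  X [ v ]≔ outside           ≡⟨ cong (X [ v ]≔_) v∉X ⟨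
  X [ v ]≔ lookup X v        ≡⟨ []≔-lookup X v ⟩
  X                          ∎
  where open ≡-Reasoning

insert-injective : ∀ {n} (v : Fin n) {X Y} → lookup X v ≡ outside → lookup Y v ≡ outside →
  insert v X ≡ insert v Y → X ≡ Y
insert-injective v {X} {Y} v∉X v∉Y eq =
  trans (sym (remove-insert v X v∉X)) (trans (cong (_[ v ]≔ outside) eq) (remove-insert v Y v∉Y))

∣p∪q∣≤∣p∣+∣q∣ : ∀ {n} (p q : Subset n) → ∣ p ∪ q ∣ ≤ ∣ p ∣ + ∣ q ∣
∣p∪q∣≤∣p∣+∣q∣ []            []            = z≤n
∣p∪q∣≤∣p∣+∣q∣ (outside ∷ p) (outside ∷ q) = ∣p∪q∣≤∣p∣+∣q∣ p q
∣p∪q∣≤∣p∣+∣q∣ (outside ∷ p) (inside ∷ q)  =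
  ℕ.≤-trans (s≤s (∣p∪q∣≤∣p∣+∣q∣ p q)) (ℕ.≤-reflexive (sym (ℕ.+-suc ∣ p ∣ ∣ q ∣)))
∣p∪q∣≤∣p∣+∣q∣ (inside ∷ p)  (outside ∷ q) = s≤s (∣p∪q∣≤∣p∣+∣q∣ p q)
∣p∪q∣≤∣p∣+∣q∣ (inside ∷ p)  (inside ∷ q)  =
  s≤s (ℕ.≤-trans (∣p∪q∣≤∣p∣+∣q∣ p q) (ℕ.+-monoʳ-≤ ∣ p ∣ (ℕ.n≤1+n ∣ q ∣)))

map-insert-distinct : ∀ {n r} (v : Fin n) (Ss : Vec (Subset n) r) →
  (∀ a → lookup (lookup Ss a) v ≡ outside) → (∀ a b → lookup Ss a ≡ lookup Ss b → a ≡ b) →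
  ∀ a b → lookup (Vec.map (insert v) Ss) a ≡ lookup (Vec.map (insert v) Ss) b → a ≡ b
map-insert-distinct v Ss v∉S distinct a b eq = distinct a b (insert-injective v (v∉S a) (v∉S b)
  (trans (sym (lookup-map a (insert v) Ss)) (trans eq (lookup-map b (insert v) Ss))))

map-insert-sizes : ∀ {n r i} (v : Fin n) (Ss : Vec (Subset n) r) →
  (∀ a → lookup (lookup Ss a) v ≡ outside) → (∀ a → ∣ lookup Ss a ∣ ≡ i) →
  ∀ a → ∣ lookup (Vec.map (insert v) Ss) a ∣ ≡ suc i
map-insert-sizes v Ss v∉S sizes a =
  trans (cong ∣_∣ (lookup-map a (insert v) Ss)) (trans (∣insert∣ v (lookup Ss a) (v∉S a)) (cong suc (sizes a)))

count≤∑-count-insert : ∀ {n} (P : Subset n → Bool) → ¬ T (P ⊥) →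
  count P ≤ ∑[ v < n ] count (λ X → not (lookup X v) ∧ P (insert v X))
count≤∑-count-insert {zero}  P ¬P⊥ = ℕ.≤-reflexive (count-none P λ { [] → ¬P⊥ })
-- A set containing 0 is counted by the term v = 0, one avoiding 0 by induction.
count≤∑-count-insert {suc n} P ¬P⊥ = begin
  count P                                                ≡⟨ count-∷ P ⟩
  count (P ∘ (outside ∷_)) + count (P ∘ (inside ∷_))     ≤⟨ ℕ.+-mono-≤ outside-part (count-∘outside≤ (link zero)) ⟩
  ∑[ w < n ] count (link (suc w)) + count (link zero)    ≡⟨ ℕ.+-comm _ (count (link zero)) ⟩
  count (link zero) + ∑[ w < n ] count (link (suc w))    ∎
  where
  open ℕ.≤-Reasoning
  link : Fin (suc n) → Subset (suc n) → Bool
  link v X = not (lookup X v) ∧ P (insert v X)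
  outside-part : count (P ∘ (outside ∷_)) ≤ ∑[ w < n ] count (link (suc w))
  outside-part = ℕ.≤-trans (count≤∑-count-insert (P ∘ (outside ∷_)) ¬P⊥)
                           (∑-mono-≤ (λ w → count-∘outside≤ (link (suc w))))

ℕ→ℚ≡mkℚ : ∀ m → ℕ→ℚ m ≡ mkℚ (ℤ.+ m) 0 (Coprime.sym (Coprime.1-coprimeTo m))
ℕ→ℚ≡mkℚ m = ℚ.normalize-coprime (Coprime.sym (Coprime.1-coprimeTo m))

ℕ→ℚ-+ : ∀ a b → ℕ→ℚ (a + b) ≡ ℕ→ℚ a ℚ.+ ℕ→ℚ b
ℕ→ℚ-+ a b rewrite ℕ→ℚ≡mkℚ a | ℕ→ℚ≡mkℚ b =
  sym (cong (ℚ._/ 1) (cong₂ ℤ._+_ (ℤ.*-identityʳ (ℤ.+ a)) (ℤ.*-identityʳ (ℤ.+ b))))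

ℕ→ℚ-mono-≤ : ∀ {a b} → a ≤ b → ℕ→ℚ a ≤ℚ ℕ→ℚ b
ℕ→ℚ-mono-≤ {a} {b} a≤b rewrite ℕ→ℚ≡mkℚ a | ℕ→ℚ≡mkℚ b =
  *≤* (subst₂ ℤ._≤_ (sym (ℤ.*-identityʳ (ℤ.+ a))) (sym (ℤ.*-identityʳ (ℤ.+ b))) (ℤ.+≤+ a≤b))

0≤ℕ→ℚ : ∀ m → 0ℚ ≤ℚ ℕ→ℚ m
0≤ℕ→ℚ m = ℕ→ℚ-mono-≤ {0} {m} z≤n

nonNeg*nonNeg : ∀ {x y} → 0ℚ ≤ℚ x → 0ℚ ≤ℚ y → 0ℚ ≤ℚ x ℚ.* y
nonNeg*nonNeg {x} {y} 0≤x 0≤y =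
  ℚ.nonNegative⁻¹ (x ℚ.* y) {{ℚ.nonNeg*nonNeg⇒nonNeg x {{ℚ.nonNegative 0≤x}} y {{ℚ.nonNegative 0≤y}}}}

^ℚ-nonNeg : ∀ {q} r → 0ℚ ≤ℚ q → 0ℚ ≤ℚ q ^ℚ r
^ℚ-nonNeg zero    0≤q = 0≤ℕ→ℚ 1
^ℚ-nonNeg (suc r) 0≤q = nonNeg*nonNeg 0≤q (^ℚ-nonNeg r 0≤q)

ℕ→ℚ-∑≤ : ∀ {m} {f : Fin m → ℕ} {B} → (∀ v → ℕ→ℚ (f v) ≤ℚ B) →
  ℕ→ℚ (∑[ v < m ] f v) ≤ℚ ℕ→ℚ m ℚ.* B
ℕ→ℚ-∑≤ {zero}      {B = B} _   = ℚ.≤-reflexive (sym (ℚ.*-zeroˡ B))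
ℕ→ℚ-∑≤ {suc m} {f} {B}     f≤B = begin
  ℕ→ℚ (f zero + ∑[ v < m ] f (suc v))          ≡⟨ ℕ→ℚ-+ (f zero) _ ⟩
  ℕ→ℚ (f zero) ℚ.+ ℕ→ℚ (∑[ v < m ] f (suc v))  ≤⟨ ℚ.+-mono-≤ (f≤B zero) (ℕ→ℚ-∑≤ (f≤B ∘ suc)) ⟩
  B ℚ.+ ℕ→ℚ m ℚ.* B                             ≡⟨ solve 2 (λ x b → b :+ x :* b := (con 1ℚ :+ x) :* b) refl (ℕ→ℚ m) B ⟩
  (1ℚ ℚ.+ ℕ→ℚ m) ℚ.* B                          ≡⟨ cong (ℚ._* B) (ℕ→ℚ-+ 1 m) ⟨
  ℕ→ℚ (suc m) ℚ.* B                             ∎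
  where
  open ℚ.≤-Reasoning
  open +-*-Solver

∸-suc : ∀ {i k} → i < k → k ∸ i ≡ suc (k ∸ suc i)
∸-suc i<k = ℕ.+-∸-assoc 1 i<k

module _ {n k} (G : Hypergraph n k) where

  edgeWithAll : ∀ {r} → Vec (Subset n) r → Subset n → Bool
  edgeWithAll Ss X = Vec.foldr (λ _ → Bool) (λ S b → edge G (S ∪ X) ∧ b) true Ss

  commonNbhd : ∀ {r} → ℕ → Vec (Subset n) r → Subset n → Bool
  commonNbhd i Ss X = (∣ X ∣ ≡ᵇ k ∸ i) ∧ edgeWithAll Ss X

  edgeWithAll⇒edge : ∀ {r} (Ss : Vec (Subset n) r) {X} → T (edgeWithAll Ss X) →
    ∀ a → T (edge G (lookup Ss a ∪ X))
  edgeWithAll⇒edge (S ∷ Ss) h zero    = proj₁ (to T-∧ h)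
  edgeWithAll⇒edge (S ∷ Ss) h (suc a) = edgeWithAll⇒edge Ss (proj₂ (to (T-∧ {edge G (S ∪ _)}) h)) a

  edgeWithAll-insert : ∀ {r} v (Ss : Vec (Subset n) r) X →
    edgeWithAll (Vec.map (insert v) Ss) X ≡ edgeWithAll Ss (insert v X)
  edgeWithAll-insert v []       X = refl
  edgeWithAll-insert v (S ∷ Ss) X =
    cong₂ _∧_ (cong (edge G) (sym (∪-insert-swap v S X))) (edgeWithAll-insert v Ss X)

  linkNbhd : ∀ {r} → ℕ → Vec (Subset n) r → Fin n → Subset n → Bool
  linkNbhd i Ss v X = not (lookup X v) ∧ commonNbhd i Ss (insert v X)

  linkNbhd-elim : ∀ {r i} (Ss : Vec (Subset n) r) {v} X → T (linkNbhd i Ss v X) →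
    lookup X v ≡ outside × ∣ insert v X ∣ ≡ k ∸ i × T (edgeWithAll Ss (insert v X))
  linkNbhd-elim {i = i} Ss {v} X h =
    let v∉X , hN = to (T-∧ {not (lookup X v)}) h
        size , edges = to (T-∧ {∣ insert v X ∣ ≡ᵇ k ∸ i}) hN
    in to T-not-≡ v∉X , ℕ.≡ᵇ⇒≡ _ _ size , edges

  ¬linkNbhd-∈ : ∀ {r i} (Ss : Vec (Subset n) r) {v} X → i < k →
    (∀ a → ∣ lookup Ss a ∣ ≡ i) → ∀ a → lookup (lookup Ss a) v ≡ inside → ¬ T (linkNbhd i Ss v X)
  ¬linkNbhd-∈ {i = i} Ss {v} X i<k sizes a v∈Sₐ h with linkNbhd-elim {i = i} Ss X h
  ... | v∉X , ∣X+v∣≡k-i , edges = ℕ.<⇒≱ i+∣X∣<k k≤i+∣X∣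
    where
    open ℕ.≤-Reasoning
    k≤i+∣X∣ : k ≤ i + ∣ X ∣
    k≤i+∣X∣ = begin
      k                             ≡⟨ uniform G _ (to T-≡ (edgeWithAll⇒edge Ss edges a)) ⟨
      ∣ lookup Ss a ∪ insert v X ∣  ≡⟨ cong ∣_∣ (∪-insert-absorb v (lookup Ss a) X v∈Sₐ) ⟩
      ∣ lookup Ss a ∪ X ∣           ≤⟨ ∣p∪q∣≤∣p∣+∣q∣ (lookup Ss a) X ⟩
      ∣ lookup Ss a ∣ + ∣ X ∣       ≡⟨ cong (_+ ∣ X ∣) (sizes a) ⟩
      i + ∣ X ∣                     ∎
    i+∣X∣<k : i + ∣ X ∣ < k
    i+∣X∣<k = begin-strict
      i + ∣ X ∣          <⟨ ℕ.+-monoʳ-< i (ℕ.n<1+n ∣ X ∣) ⟩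
      i + suc ∣ X ∣      ≡⟨ cong (i +_) (∣insert∣ v X v∉X) ⟨
      i + ∣ insert v X ∣ ≡⟨ cong (i +_) ∣X+v∣≡k-i ⟩
      i + (k ∸ i)        ≡⟨ ℕ.m+[n∸m]≡n (ℕ.<⇒≤ i<k) ⟩
      k                  ∎

  linkNbhd⇒commonNbhd-insert : ∀ {r i} (Ss : Vec (Subset n) r) {v} X → i < k →
    T (linkNbhd i Ss v X) → T (commonNbhd (suc i) (Vec.map (insert v) Ss) X)
  linkNbhd⇒commonNbhd-insert {i = i} Ss {v} X i<k h with linkNbhd-elim {i = i} Ss X h
  ... | v∉X , ∣X+v∣≡k-i , edges =
    from T-∧ (ℕ.≡⇒≡ᵇ _ _ ∣X∣≡k-i-1 , subst T (sym (edgeWithAll-insert v Ss X)) edges)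
    where
    open ≡-Reasoning
    ∣X∣≡k-i-1 : ∣ X ∣ ≡ k ∸ suc i
    ∣X∣≡k-i-1 = ℕ.suc-injective (begin
      suc ∣ X ∣        ≡⟨ ∣insert∣ v X v∉X ⟨
      ∣ insert v X ∣   ≡⟨ ∣X+v∣≡k-i ⟩
      k ∸ i            ≡⟨ ∸-suc i<k ⟩
      suc (k ∸ suc i)  ∎)

  BDDᵢ-suc⇒BDDᵢ : ∀ {i d C p} → 0ℚ ≤ℚ p → i < k → BDDᵢ G (suc i) d C p → BDDᵢ G i d C p
  BDDᵢ-suc⇒BDDᵢ {i} {d} {C} {p} 0≤p i<k bdd r 1≤r r≤d Ss distinct sizes = begin
    ℕ→ℚ (commonNbhdSize G i Ss)               ≤⟨ ℕ→ℚ-mono-≤ (count≤∑-count-insert (commonNbhd i Ss) ∅∉N) ⟩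
    ℕ→ℚ (∑[ v < n ] count (linkNbhd i Ss v)) ≤⟨ ℕ→ℚ-∑≤ count-linkNbhd≤B ⟩
    ℕ→ℚ n ℚ.* B                               ≡⟨ solve 4 (λ x c y z → x :* (c :* y :* z) := c :* (x :* y) :* z)
                                                         refl (ℕ→ℚ n) (ℕ→ℚ C) (ℕ→ℚ n ^ℚ m) (p ^ℚ r) ⟩
    ℕ→ℚ C ℚ.* ℕ→ℚ n ^ℚ suc m ℚ.* p ^ℚ r        ≡⟨ cong (λ e → ℕ→ℚ C ℚ.* ℕ→ℚ n ^ℚ e ℚ.* p ^ℚ r) (∸-suc i<k) ⟨
    ℕ→ℚ C ℚ.* ℕ→ℚ n ^ℚ (k ∸ i) ℚ.* p ^ℚ r      ∎
    where
    open ℚ.≤-Reasoning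
    open +-*-Solver
    m : ℕ
    m = k ∸ suc i
    B : ℚ
    B = ℕ→ℚ C ℚ.* ℕ→ℚ n ^ℚ m ℚ.* p ^ℚ r
    0≤B : 0ℚ ≤ℚ B
    0≤B = nonNeg*nonNeg (nonNeg*nonNeg (0≤ℕ→ℚ C) (^ℚ-nonNeg m (0≤ℕ→ℚ n))) (^ℚ-nonNeg r 0≤p)
    ∅∉N : ¬ T (commonNbhd i Ss ⊥)
    ∅∉N h = ℕ.0≢1+n (trans (sym (∣⊥∣≡0 n)) (trans (ℕ.≡ᵇ⇒≡ _ _ (proj₁ (to T-∧ h))) (∸-suc i<k)))
    count-linkNbhd≤B : ∀ v → ℕ→ℚ (count (linkNbhd i Ss v)) ≤ℚ B
    count-linkNbhd≤B v with any? (λ a → lookup (lookup Ss a) v Bool.≟ inside)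
    ... | yes (a , v∈Sₐ) = subst (λ c → ℕ→ℚ c ≤ℚ B) (sym no-link) 0≤B
      where
      no-link : count (linkNbhd i Ss v) ≡ 0
      no-link = count-none (linkNbhd i Ss v) λ X → ¬linkNbhd-∈ Ss X i<k sizes a v∈Sₐ
    ... | no  v∉S = ℚ.≤-trans (ℕ→ℚ-mono-≤ (count-mono (λ X → linkNbhd⇒commonNbhd-insert Ss X i<k)))
                              (bdd r 1≤r r≤d (Vec.map (insert v) Ss)
                                   (map-insert-distinct v Ss v∉Sₐ distinct) (map-insert-sizes v Ss v∉Sₐ sizes))
      where
      v∉Sₐ : ∀ a → lookup (lookup Ss a) v ≡ outside
      v∉Sₐ a = ¬-not (λ v∈Sₐ → v∉S (a , v∈Sₐ))

downward-induction : ∀ {ℓ} (P : ℕ → Set ℓ) {t} → (∀ {i} → i < t → P (suc i) → P i) → P t →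
  ∀ {i} → i ≤ t → P i
downward-induction P {t} step Pt {i} i≤t = go (t ∸ i) (ℕ.m+[n∸m]≡n i≤t)
  where
  go : ∀ j {i} → i + j ≡ t → P i
  go zero    {i} i+0≡t   = subst P (trans (sym i+0≡t) (ℕ.+-identityʳ i)) Pt
  go (suc j) {i} i+1+j≡t =
    step (subst (i <_) i+1+j≡t (ℕ.m<m+n i z<s)) (go j (trans (sym (ℕ.+-suc i j)) i+1+j≡t))

lemma2p6 : (n k : ℕ) → 2 ≤ k → (C : ℕ) → 1 < C →
    (p : ℚ) → 0ℚ <ℚ p → p ≤ℚ 1ℚ →
    (G : Hypergraph n k) → BDD G 2 C p →
    (i : ℕ) → 1 ≤ i → i ≤ k ∸ 1 → BDDᵢ G i 2 C p
lemma2p6 n k _ C _ p 0<p _ G bdd i _ i≤k-1 =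
  downward-induction (λ j → BDDᵢ G j 2 C p)
    (λ j<k-1 → BDDᵢ-suc⇒BDDᵢ G {d = 2} {C} {p} (ℚ.<⇒≤ 0<p) (ℕ.<-≤-trans j<k-1 (ℕ.m∸n≤m k 1)))
    bdd i≤k-1
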